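{- Let $r\ge 1$, let $\mathcal{W}$ be a family of sequences of length $p$ over a color set $C$, and let $\mathcal{F}:=\{\pi(\sigma)\mid \sigma\in\mathcal{W}\}$. If $\widehat{\mathcal{F}}\subseteq\mathcal{F}$ is an $r$-representative of $\mathcal{F}$, then $\widehat{\mathcal{W}}:=\{\sigma\in\mathcal{W}\mid \pi(\sigma)\in\widehat{\mathcal{F}}\}$ is an $r$-ordered representative of $\mathcal{W}$.
   Context: For $\sigma=(a_1,\dots,a_p)$ define $\pi(\sigma):=\{(a_j,i)\mid i\in\{1,\dots,r\},\ j\in\{p-(r-i),\dots,p\}\cap\mathbb{N}\}\subseteq C\times\{1,\dots,r\}$ (all these sets have the same size for fixed $p$). For sequences $\sigma=(a_1,\dots,a_n)$, $\rho=(b_1,\dots,b_m)$, $\sigma$ is $r$-compatible to $\rho$ if for all $j\in\{1,\dots,r\}$: $\{a_{\max(1,n-j+1)},\dots,a_n\}\cap\{b_1,\dots,b_{\min(r-j+1,m)}\}=\emptyset$. A subfamily $\widehat{\mathcal{W}}$ of a family $\mathcal{W}$ of sequences is an $r$-ordered representative of $\mathcal{W}$ if for every sequence $\rho$ of length at most $r$: whenever some $\sigma\in\mathcal{W}$ is $r$-compatible to $\rho$, some $\widehat\sigma\in\widehat{\mathcal{W}}$ is $r$-compatible to $\rho$. For a family $\mathcal{F}$ of $p'$-element sets and $q\in\mathbb{N}$, a subfamily $\widehat{\mathcal{F}}$ is a $q$-representative of $\mathcal{F}$ if for every set $Y$ with $|Y|\le q$: whenever $\mathcal{F}$ contains a set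 disjoint from $Y$, $\widehat{\mathcal{F}}$ contains a set disjoint from $Y$. -}

module Defs where

open import Data.Nat using (ℕ; suc; _+_; _≤_)
open import Data.Fin using (Fin; toℕ)
open import Data.Vec using (Vec; lookup)
open import Data.List using (List; length)
open import Data.List.Membership.Propositional using (_∈_)
open import Data.Product using (_×_; _,_; Σ; ∃; ∃-syntax)
open import Relation.Binary.PropositionalEquality using (_≡_; _≢_)
open import Relation.Nullary using (¬_)
open import Function.Bundles using (_⇔_)

PSet : Set → Set₁
PSet A = A → Set

Family : Set → Set₁
Family A = PSet A → Set

_≐_ : {A : Set} → PSet A → PSet A → Set
S ≐ T = ∀ x → S x ⇔ T x

_∈F_ : {A : Set} → PSet A → Family A → Set₁
S ∈F 𝓕 = Σ (PSet _) λ T → 𝓕 T × (T ≐ S)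

_⊆F_ : {A : Set} → Family A → Family A → Set₁
𝓖 ⊆F 𝓕 = ∀ S → 𝓖 S → S ∈F 𝓕

DisjointL : {A : Set} → PSet A → List A → Set
DisjointL S Y = ∀ x → S x → ¬ (x ∈ Y)

-- q-representative: for every set Y with |Y| ≤ q (a finite set of size ≤ q
-- is exactly the set of members of some list of length ≤ q)
IsRepresentative : {A : Set} → ℕ → Family A → Family A → Set₁
IsRepresentative {A} q 𝓕 𝓕̂ =
  𝓕̂ ⊆F 𝓕 ×
  (∀ (Y : List A) → length Y ≤ q →
     Σ (PSet A) (λ S → 𝓕 S × DisjointL S Y) →
     Σ (PSet A) (λ S → 𝓕̂ S × DisjointL S Y))

-- π(σ) for σ = (a_1,…,a_p) (position j corresponds to Fin index j-1):
-- (c , i) ∈ π σ  iff  1 ≤ i ≤ r and ∃ j ∈ {1..p}, j ≥ p - (r - i), a_j = c.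
-- j = suc (toℕ k); the condition j ≥ p - (r - i) (for i ≤ r) is p + i ≤ j + r.
π : {C : Set} (r : ℕ) {p : ℕ} → Vec C p → PSet (C × ℕ)
π r {p} σ (c , i) =
  (1 ≤ i) × (i ≤ r) ×
  (∃[ k ] (p + i ≤ suc (toℕ k) + r) × (lookup σ k ≡ c))

-- σ (length n) is r-compatible to ρ (length m): for all j ∈ {1..r}, the last
-- j entries of σ (indices ≥ n-j+1) and the first r-j+1 entries of ρ are disjoint.
-- Position of k : Fin n is toℕ k + 1; it is ≥ n-j+1 iff n ≤ toℕ k + j.
-- Position of l : Fin m is toℕ l + 1; it is ≤ r-j+1 iff toℕ l + j ≤ r (j ≤ r).
Compatible : {C : Set} (r : ℕ) {n m : ℕ} → Vec C n → Vec C m → Set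
Compatible r {n} {m} σ ρ =
  ∀ (j : ℕ) → 1 ≤ j → j ≤ r →
  ∀ (k : Fin n) (l : Fin m) → n ≤ toℕ k + j → toℕ l + j ≤ r →
  lookup σ k ≢ lookup ρ l

-- Ŵ is an r-ordered representative of W (families of length-p sequences
-- given as predicates; Ŵ may be Set₁-valued since it refers to families of sets).
IsOrderedRepresentative : {C : Set} (r p : ℕ) → (Vec C p → Set) → (Vec C p → Set₁) → Set₁
IsOrderedRepresentative {C} r p 𝓦 𝓦̂ =
  (∀ σ → 𝓦̂ σ → 𝓦 σ) ×
  (∀ (m : ℕ) → m ≤ r → (ρ : Vec C m) →
     ∃[ σ ] (𝓦 σ × Compatible r σ ρ) →
     ∃[ σ ] (𝓦̂ σ × Compatible r σ ρ))

imageπ : {C : Set} (r p : ℕ) → (Vec C p → Set) → Family (C × ℕ)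
imageπ r p 𝓦 S = ∃[ σ ] (𝓦 σ × (S ≐ π r σ))

restrictW : {C : Set} (r p : ℕ) → (Vec C p → Set) → Family (C × ℕ) → Vec C p → Set₁
restrictW r p 𝓦 𝓕̂ σ = 𝓦 σ × (π r σ ∈F 𝓕̂)

{-# OPTIONS --safe #-}
-- Encode a sequence ρ = (b₁,…,bₘ) as the set Y_ρ = {(b_i, i) | 1 ≤ i ≤ m}, of size
-- at most m ≤ r. Since (b_i, i) ∈ π(σ) says exactly that b_i occurs among the last
-- r - i + 1 entries of σ, the condition for j = r - i + 1 in r-compatibility, σ is
-- r-compatible to ρ iff π(σ) is disjoint from Y_ρ. An r-representative of
-- {π(σ) | σ ∈ W} therefore yields, for every ρ, a sequence of Ŵ compatible to it.
module Submission where

open import Defs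
open import Data.Nat using (ℕ; suc; _+_; _∸_; _≤_; s≤s; s≤s⁻¹; z≤n)
open import Data.Nat.Properties
  using (<⇒≤; ≤-reflexive; +-suc; +-comm; +-assoc; +-monoˡ-≤; +-monoʳ-≤;
         +-∸-assoc; m+n≤o⇒m≤o∸n; m+n≤o⇒m≤o; m∸n≤m; m<n⇒0<n∸m; m+[n∸m]≡n; module ≤-Reasoning)
open import Data.Product using (_×_; _,_; proj₁; ∃-syntax)
open import Data.Vec using (Vec; lookup)
open import Data.Fin using (toℕ)
open import Data.List using (List; length; tabulate)
open import Data.List.Properties using (length-tabulate)
open import Data.List.Membership.Propositional.Properties using (∈-tabulate⁺; ∈-tabulate⁻)
open import Relation.Binary.PropositionalEquality using (_≡_; refl; sym; cong; subst)
open import Function.Bundles using (Equivalence)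
open import Function.Construct.Identity using (⇔-id)
open import Function.Construct.Symmetry using (⇔-sym)
open import Function.Construct.Composition using (_⇔-∘_)

m+[1+n]≤[1+o]+p⇒m≤o+[p∸n] : ∀ {m n o p} → n ≤ p → m + suc n ≤ suc o + p → m ≤ o + (p ∸ n)
m+[1+n]≤[1+o]+p⇒m≤o+[p∸n] {m} {n} {o} {p} n≤p le =
  subst (m ≤_) (+-∸-assoc o n≤p) (m+n≤o⇒m≤o∸n m (s≤s⁻¹ (subst (_≤ suc o + p) (+-suc m n) le)))

m≤o+j⇒n+j≤p⇒m+[1+n]≤[1+o]+p : ∀ {m n o p j} → m ≤ o + j → n + j ≤ p → m + suc n ≤ suc o + p
m≤o+j⇒n+j≤p⇒m+[1+n]≤[1+o]+p {m} {n} {o} {p} {j} m≤o+j n+j≤p = begin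
  m + suc n         ≡⟨ +-suc m n ⟩
  suc (m + n)       ≤⟨ s≤s (+-monoˡ-≤ n m≤o+j) ⟩
  suc (o + j + n)   ≡⟨ cong suc (+-assoc o j n) ⟩
  suc (o + (j + n)) ≤⟨ s≤s (+-monoʳ-≤ o (subst (_≤ p) (+-comm n j) n+j≤p)) ⟩
  suc o + p         ∎
  where
  open ≤-Reasoning

module _ {A : Set} where

  ≐-refl : {S : PSet A} → S ≐ S
  ≐-refl _ = ⇔-id _

  ≐-sym : {S T : PSet A} → S ≐ T → T ≐ S
  ≐-sym S≐T x = ⇔-sym (S≐T x)

  ≐-trans : {S T U : PSet A} → S ≐ T → T ≐ U → S ≐ U
  ≐-trans S≐T T≐U x = T≐U x ⇔-∘ S≐T x

  DisjointL-resp-≐ : {S T : PSet A} {Y : List A} → S ≐ T → DisjointL S Y → DisjointL T Y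
  DisjointL-resp-≐ S≐T S#Y x Tx = S#Y x (Equivalence.from (S≐T x) Tx)

encode : {C : Set} {m : ℕ} → Vec C m → List (C × ℕ)
encode ρ = tabulate λ l → lookup ρ l , suc (toℕ l)

length-encode : {C : Set} {m : ℕ} (ρ : Vec C m) → length (encode ρ) ≡ m
length-encode _ = length-tabulate _

module _ {C : Set} (r : ℕ) {p m : ℕ} (σ : Vec C p) (ρ : Vec C m) where

  compatible⇒disjoint-π : Compatible r σ ρ → DisjointL (π r σ) (encode ρ)
  compatible⇒disjoint-π σ~ρ x (_ , i≤r , k , window , σk≡c) x∈Y with ∈-tabulate⁻ x∈Y
  ... | l , refl =
    σ~ρ (r ∸ toℕ l) (m<n⇒0<n∸m i≤r) (m∸n≤m r (toℕ l)) k l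
      (m+[1+n]≤[1+o]+p⇒m≤o+[p∸n] (<⇒≤ i≤r) window) (≤-reflexive (m+[n∸m]≡n (<⇒≤ i≤r))) σk≡c

  disjoint-π⇒compatible : DisjointL (π r σ) (encode ρ) → Compatible r σ ρ
  disjoint-π⇒compatible σ#ρ (suc j) _ _ k l suffix prefix σk≡ρl =
    σ#ρ (lookup ρ l , suc (toℕ l)) (s≤s z≤n , l<r , k , window , σk≡ρl) (∈-tabulate⁺ l)
    where
    l<r : suc (toℕ l) ≤ r
    l<r = m+n≤o⇒m≤o (suc (toℕ l)) (subst (_≤ r) (+-suc (toℕ l) j) prefix)
    window : p + suc (toℕ l) ≤ suc (toℕ k) + r
    window = m≤o+j⇒n+j≤p⇒m+[1+n]≤[1+o]+p suffix prefix

⊆F-imageπ⇒restrictW : {C : Set} (r p : ℕ) (𝓦 : Vec C p → Set) {𝓕̂ : Family (C × ℕ)} →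
  𝓕̂ ⊆F imageπ r p 𝓦 → ∀ {S} → 𝓕̂ S → ∃[ σ ] (restrictW r p 𝓦 𝓕̂ σ × S ≐ π r σ)
⊆F-imageπ⇒restrictW r p 𝓦 𝓕̂⊆𝓕 {S} S∈𝓕̂ with 𝓕̂⊆𝓕 S S∈𝓕̂
... | T , (σ , σ∈𝓦 , T≐πσ) , T≐S = σ , (σ∈𝓦 , S , S∈𝓕̂ , S≐πσ) , S≐πσ
  where
  S≐πσ : S ≐ π r σ
  S≐πσ = ≐-trans (≐-sym T≐S) T≐πσ

lemma6 : {C : Set} (r p : ℕ) → 1 ≤ r →
    (𝓦 : Vec C p → Set) → (𝓕̂ : Family (C × ℕ)) →
    IsRepresentative r (imageπ r p 𝓦) 𝓕̂ →
    IsOrderedRepresentative r p 𝓦 (restrictW r p 𝓦 𝓕̂)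
lemma6 r p _ 𝓦 𝓕̂ (𝓕̂⊆𝓕 , representative) = (λ _ → proj₁) , ordered-representative
  where
  ordered-representative : ∀ m → m ≤ r → (ρ : Vec _ m) →
    ∃[ σ ] (𝓦 σ × Compatible r σ ρ) → ∃[ σ ] (restrictW r p 𝓦 𝓕̂ σ × Compatible r σ ρ)
  ordered-representative m m≤r ρ (σ , σ∈𝓦 , σ~ρ)
    with representative (encode ρ) (subst (_≤ r) (sym (length-encode ρ)) m≤r)
           (π r σ , (σ , σ∈𝓦 , ≐-refl) , compatible⇒disjoint-π r σ ρ σ~ρ)
  ... | S , S∈𝓕̂ , S#ρ with ⊆F-imageπ⇒restrictW r p 𝓦 𝓕̂⊆𝓕 S∈𝓕̂
  ... | σ̂ , σ̂∈𝓦̂ , S≐πσ̂ = σ̂ , σ̂∈𝓦̂ , disjoint-π⇒compatible r σ̂ ρ (DisjointL-resp-≐ S≐πσ̂ S#ρ)
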